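{- Let $R = \mathbb{F}_2[x,t]/(x^2+tx+t^2+t+1)$, and let $m = m_0 + x m_1$ and $f = f_0 + x f_1$ be elements of $R$ with $m_0,m_1,f_0,f_1\in\mathbb{F}_2[t]$. If $\deg m_1 - \deg m_0 < -1$, then $\deg(mf) = \deg m + \deg f$.
   Context: Every element $g\in R$ is uniquely written $g = g_0(t) + x g_1(t)$ with $g_0,g_1\in\mathbb{F}_2[t]$, and $\deg g := \max\{\deg g_0,\deg g_1\}$ (the total $t$-degree); the degree of the zero polynomial is $-\infty$. -}

module Defs where

open import Data.Bool using (Bool; true; false; _xor_; _∧_; if_then_else_)
open import Data.List using (List; []; _∷_)
open import Data.Nat using (ℕ; zero; suc; _+_; _⊔_) renaming (_≤_ to _≤ℕ_)
open import Data.Product using (_×_; _,_; proj₁; proj₂)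

-- Polynomials over F₂ = Bool (xor is +, ∧ is *), as coefficient lists,
-- lowest degree first.  Trailing zeros are allowed; the degree ignores them.

F2[t] : Set
F2[t] = List Bool

_+ₚ_ : F2[t] → F2[t] → F2[t]
[] +ₚ q = q
(a ∷ p) +ₚ [] = a ∷ p
(a ∷ p) +ₚ (b ∷ q) = (a xor b) ∷ (p +ₚ q)

_·ₚ_ : Bool → F2[t] → F2[t]
c ·ₚ [] = []
c ·ₚ (b ∷ q) = (c ∧ b) ∷ (c ·ₚ q)

_*ₚ_ : F2[t] → F2[t] → F2[t]
[] *ₚ q = []
(a ∷ p) *ₚ q = (a ·ₚ q) +ₚ (false ∷ (p *ₚ q))

tₚ : F2[t]
tₚ = false ∷ true ∷ []

t²+t+1 : F2[t]
t²+t+1 = true ∷ true ∷ true ∷ []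

data Deg : Set where
  -∞  : Deg
  fin : ℕ → Deg

_+ᵈ_ : Deg → Deg → Deg
-∞ +ᵈ e = -∞
fin m +ᵈ -∞ = -∞
fin m +ᵈ fin n = fin (m + n)

maxᵈ : Deg → Deg → Deg
maxᵈ -∞ e = e
maxᵈ (fin m) -∞ = fin m
maxᵈ (fin m) (fin n) = fin (m ⊔ n)

data _≤ᵈ_ : Deg → Deg → Set where
  -∞≤   : ∀ {e} → -∞ ≤ᵈ e
  fin≤  : ∀ {m n} → m ≤ℕ n → fin m ≤ᵈ fin n

degₚ : F2[t] → Deg
degₚ [] = -∞
degₚ (a ∷ p) with degₚ p
... | fin n = fin (suc n)
... | -∞ = if a then fin 0 else -∞

-- R = F₂[x,t]/(x² + t x + t² + t + 1); an element g₀ + x g₁ is the pair (g₀ , g₁).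

R : Set
R = F2[t] × F2[t]

-- Using x² = t x + (t² + t + 1) (characteristic 2):
-- (a₀ + x a₁)(b₀ + x b₁) = (a₀b₀ + (t²+t+1) a₁b₁) + x (a₀b₁ + a₁b₀ + t a₁b₁)
_*ᴿ_ : R → R → R
(a₀ , a₁) *ᴿ (b₀ , b₁) =
  ((a₀ *ₚ b₀) +ₚ (t²+t+1 *ₚ (a₁ *ₚ b₁))) ,
  (((a₀ *ₚ b₁) +ₚ (a₁ *ₚ b₀)) +ₚ (tₚ *ₚ (a₁ *ₚ b₁)))

degᴿ : R → Deg
degᴿ (g₀ , g₁) = maxᵈ (degₚ g₀) (degₚ g₁)

-- Write m₀, m₁, f₀, f₁ for the degrees of the coefficient polynomials.  The
-- product has components m₀f₀ + (t²+t+1)m₁f₁ and m₀f₁ + m₁f₀ + t m₁f₁, and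
-- since m₁ + 2 ≤ m₀ every term involving m₁ is dominated by its neighbour
-- involving m₀, except that (t²+t+1)m₁f₁ may tie with m₀f₀ when f₀ = f₁.  So
-- if f₀ ≤ f₁ the second component has the exact degree m₀ + f₁ and the first
-- is at most that, while if f₁ < f₀ the first component has the exact degree
-- m₀ + f₀ and the second is at most that.
module Submission where

open import Data.Bool using (Bool; true; false; _xor_; if_then_else_)
open import Data.Bool.Properties using (xor-comm)
open import Data.List using ([]; _∷_)
open import Data.Nat using (ℕ; zero; suc; _<_; z≤n; s≤s)
open import Data.Nat.Properties
  using (≤-refl; ≤-trans; m≤m+n; <⇒≤; ≤-<-connex; m≤n+m; +-assoc; +-comm; +-mono-≤;
         +-mono-<-≤; +-mono-≤-<; m≤n⇒m⊔n≡n; m≥n⇒m⊔n≡m)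
open import Data.Product using (_,_)
open import Data.Sum using (_⊎_; inj₁; inj₂; [_,_]′)
open import Relation.Binary.PropositionalEquality
  using (_≡_; refl; sym; trans; cong; cong₂; subst; subst₂; module ≡-Reasoning)

open import Defs

open ≡-Reasoning

-- d ≺ᵈ e says that adding a term of degree d to one of degree e does not
-- change the degree; unlike a strict order it has -∞ ≺ᵈ -∞.
infix 4 _≺ᵈ_
data _≺ᵈ_ : Deg → Deg → Set where
  -∞≺  : ∀ {e} → -∞ ≺ᵈ e
  fin≺ : ∀ {m n} → m < n → fin m ≺ᵈ fin n

≤ᵈ-refl : ∀ {d} → d ≤ᵈ d
≤ᵈ-refl { -∞}   = -∞≤
≤ᵈ-refl {fin n} = fin≤ ≤-refl

≺ᵈ⇒≤ᵈ : ∀ {d e} → d ≺ᵈ e → d ≤ᵈ e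
≺ᵈ⇒≤ᵈ -∞≺        = -∞≤
≺ᵈ⇒≤ᵈ (fin≺ m<n) = fin≤ (<⇒≤ m<n)

≤ᵈ-∞⇒≺ᵈ : ∀ {d e} → d ≤ᵈ -∞ → d ≺ᵈ e
≤ᵈ-∞⇒≺ᵈ -∞≤ = -∞≺

≺ᵈ-∞ : ∀ {d} → d ≺ᵈ -∞ → d ≡ -∞
≺ᵈ-∞ -∞≺ = refl

≤ᵈ-or-≻ᵈ : ∀ d e → d ≤ᵈ e ⊎ e ≺ᵈ d
≤ᵈ-or-≻ᵈ -∞      e       = inj₁ -∞≤
≤ᵈ-or-≻ᵈ (fin m) -∞      = inj₂ -∞≺
≤ᵈ-or-≻ᵈ (fin m) (fin n) with ≤-<-connex m n
... | inj₁ m≤n = inj₁ (fin≤ m≤n)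
... | inj₂ n<m = inj₂ (fin≺ n<m)

+ᵈ-fin-≤ᵈ⇒≤ᵈ : ∀ {d e k} → (d +ᵈ fin k) ≤ᵈ e → d ≤ᵈ e
+ᵈ-fin-≤ᵈ⇒≤ᵈ { -∞}          _              = -∞≤
+ᵈ-fin-≤ᵈ⇒≤ᵈ {fin m} {k = k} (fin≤ m+k≤n) = fin≤ (≤-trans (m≤m+n m k) m+k≤n)

fin1+ᵈ≤ᵈ⇒≺ᵈ : ∀ {d e} → (fin 1 +ᵈ d) ≤ᵈ e → d ≺ᵈ e
fin1+ᵈ≤ᵈ⇒≺ᵈ { -∞}   _          = -∞≺
fin1+ᵈ≤ᵈ⇒≺ᵈ {fin m} (fin≤ 1+m≤n) = fin≺ 1+m≤n

≺ᵈ-fin-suc+ᵈ : ∀ k d → d ≺ᵈ fin (suc k) +ᵈ d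
≺ᵈ-fin-suc+ᵈ k -∞      = -∞≺
≺ᵈ-fin-suc+ᵈ k (fin n) = fin≺ (s≤s (m≤n+m n k))

+ᵈ-identityˡ : ∀ d → fin 0 +ᵈ d ≡ d
+ᵈ-identityˡ -∞      = refl
+ᵈ-identityˡ (fin n) = refl

+ᵈ-comm : ∀ d e → d +ᵈ e ≡ e +ᵈ d
+ᵈ-comm -∞      -∞      = refl
+ᵈ-comm -∞      (fin n) = refl
+ᵈ-comm (fin m) -∞      = refl
+ᵈ-comm (fin m) (fin n) = cong fin (+-comm m n)

+ᵈ-assoc : ∀ c d e → (c +ᵈ d) +ᵈ e ≡ c +ᵈ (d +ᵈ e)
+ᵈ-assoc -∞      d       e       = refl
+ᵈ-assoc (fin l) -∞      e       = refl
+ᵈ-assoc (fin l) (fin m) -∞      = refl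
+ᵈ-assoc (fin l) (fin m) (fin n) = cong fin (+-assoc l m n)

+ᵈ-mono-≤ᵈ : ∀ {a b c d} → a ≤ᵈ b → c ≤ᵈ d → (a +ᵈ c) ≤ᵈ (b +ᵈ d)
+ᵈ-mono-≤ᵈ -∞≤       _         = -∞≤
+ᵈ-mono-≤ᵈ (fin≤ _)  -∞≤       = -∞≤
+ᵈ-mono-≤ᵈ (fin≤ p)  (fin≤ q)  = fin≤ (+-mono-≤ p q)

+ᵈ-mono-≺ᵈ-≤ᵈ : ∀ {a b c d} → a ≺ᵈ b → c ≤ᵈ d → a +ᵈ c ≺ᵈ b +ᵈ d
+ᵈ-mono-≺ᵈ-≤ᵈ -∞≺      _        = -∞≺
+ᵈ-mono-≺ᵈ-≤ᵈ (fin≺ _) -∞≤      = -∞≺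
+ᵈ-mono-≺ᵈ-≤ᵈ (fin≺ p) (fin≤ q) = fin≺ (+-mono-<-≤ p q)

+ᵈ-mono-≤ᵈ-≺ᵈ : ∀ {a b c d} → a ≤ᵈ b → c ≺ᵈ d → a +ᵈ c ≺ᵈ b +ᵈ d
+ᵈ-mono-≤ᵈ-≺ᵈ -∞≤      _        = -∞≺
+ᵈ-mono-≤ᵈ-≺ᵈ (fin≤ _) -∞≺      = -∞≺
+ᵈ-mono-≤ᵈ-≺ᵈ (fin≤ p) (fin≺ q) = fin≺ (+-mono-≤-< p q)

≤ᵈ-respˡ-≡ : ∀ {a b c} → a ≡ b → a ≤ᵈ c → b ≤ᵈ c
≤ᵈ-respˡ-≡ refl a≤c = a≤c

≺ᵈ-respˡ-≡ : ∀ {a b c} → a ≡ b → a ≺ᵈ c → b ≺ᵈ c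
≺ᵈ-respˡ-≡ refl a≺c = a≺c

maxᵈ-≡ˡ : ∀ {d e} → e ≤ᵈ d → maxᵈ d e ≡ d
maxᵈ-≡ˡ { -∞}   -∞≤      = refl
maxᵈ-≡ˡ {fin n} -∞≤      = refl
maxᵈ-≡ˡ         (fin≤ p) = cong fin (m≥n⇒m⊔n≡m p)

maxᵈ-≡ʳ : ∀ {d e} → d ≤ᵈ e → maxᵈ d e ≡ e
maxᵈ-≡ʳ -∞≤      = refl
maxᵈ-≡ʳ (fin≤ p) = cong fin (m≤n⇒m⊔n≡n p)

cons-deg : Bool → Deg → Deg
cons-deg a (fin n) = fin (suc n)
cons-deg a -∞      = if a then fin 0 else -∞

degₚ-∷ : ∀ a p → degₚ (a ∷ p) ≡ cons-deg a (degₚ p)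
degₚ-∷ a p with degₚ p
... | fin n = refl
... | -∞    = refl

cons-deg-false : ∀ d → cons-deg false d ≡ fin 1 +ᵈ d
cons-deg-false (fin n) = refl
cons-deg-false -∞      = refl

cons-deg-≺ᵈ : ∀ {a b d e} → cons-deg b e ≺ᵈ cons-deg a d → e ≺ᵈ d
cons-deg-≺ᵈ {e = -∞}                                  _                = -∞≺
cons-deg-≺ᵈ              {d = fin n}  {e = fin m} (fin≺ (s≤s m<n)) = fin≺ m<n
cons-deg-≺ᵈ {a = true}   {d = -∞}     {e = fin m} (fin≺ ())
cons-deg-≺ᵈ {a = false}  {d = -∞}     {e = fin m} ()

cons-deg-xor : ∀ {a b d e} → cons-deg b e ≺ᵈ cons-deg a d → cons-deg (a xor b) d ≡ cons-deg a d
cons-deg-xor {d = fin n}                   _         = refl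
cons-deg-xor {true}  {false} { -∞}         _         = refl
cons-deg-xor {false} {false} { -∞}         _         = refl
cons-deg-xor {true}  {true}  { -∞} { -∞}   (fin≺ ())
cons-deg-xor {true}  {true}  { -∞} {fin m} (fin≺ ())
cons-deg-xor {false} {true}  { -∞} { -∞}   ()
cons-deg-xor {false} {true}  { -∞} {fin m} ()

predᵈ : ℕ → Deg
predᵈ zero    = -∞
predᵈ (suc k) = fin k

cons-deg-≤ᵈ-fin : ∀ a {d} k → d ≤ᵈ predᵈ k → cons-deg a d ≤ᵈ fin k
cons-deg-≤ᵈ-fin true  { -∞}   k       _        = fin≤ z≤n
cons-deg-≤ᵈ-fin false { -∞}   k       _        = -∞≤
cons-deg-≤ᵈ-fin a     {fin n} (suc k) (fin≤ p) = fin≤ (s≤s p)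

cons-deg-≤ᵈ-fin⁻¹ : ∀ {a} d k → cons-deg a d ≤ᵈ fin k → d ≤ᵈ predᵈ k
cons-deg-≤ᵈ-fin⁻¹ -∞      k       _              = -∞≤
cons-deg-≤ᵈ-fin⁻¹ (fin n) (suc k) (fin≤ (s≤s p)) = fin≤ p

+ₚ-comm : ∀ p q → p +ₚ q ≡ q +ₚ p
+ₚ-comm []      []      = refl
+ₚ-comm []      (b ∷ q) = refl
+ₚ-comm (a ∷ p) []      = refl
+ₚ-comm (a ∷ p) (b ∷ q) = cong₂ _∷_ (xor-comm a b) (+ₚ-comm p q)

degₚ-+-≺ᵈ : ∀ p q → degₚ q ≺ᵈ degₚ p → degₚ (p +ₚ q) ≡ degₚ p
degₚ-+-≺ᵈ []      q       q≺p = ≺ᵈ-∞ q≺p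
degₚ-+-≺ᵈ (a ∷ p) []      _   = refl
degₚ-+-≺ᵈ (a ∷ p) (b ∷ q) q≺p = begin
  degₚ ((a xor b) ∷ (p +ₚ q))        ≡⟨ degₚ-∷ (a xor b) (p +ₚ q) ⟩
  cons-deg (a xor b) (degₚ (p +ₚ q)) ≡⟨ cong (cons-deg (a xor b)) (degₚ-+-≺ᵈ p q (cons-deg-≺ᵈ {a} {b} heads)) ⟩
  cons-deg (a xor b) (degₚ p)        ≡⟨ cons-deg-xor {a} {b} {degₚ p} {degₚ q} heads ⟩
  cons-deg a (degₚ p)                ≡⟨ degₚ-∷ a p ⟨
  degₚ (a ∷ p)                       ∎
  where
  heads : cons-deg b (degₚ q) ≺ᵈ cons-deg a (degₚ p)
  heads = subst₂ _≺ᵈ_ (degₚ-∷ b q) (degₚ-∷ a p) q≺p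

degₚ-+-≺ᵈʳ : ∀ p q → degₚ p ≺ᵈ degₚ q → degₚ (p +ₚ q) ≡ degₚ q
degₚ-+-≺ᵈʳ p q p≺q = trans (cong degₚ (+ₚ-comm p q)) (degₚ-+-≺ᵈ q p p≺q)

degₚ-+-≡ : ∀ p q {d} → degₚ p ≡ d → degₚ q ≺ᵈ d → degₚ (p +ₚ q) ≡ d
degₚ-+-≡ p q refl q≺p = degₚ-+-≺ᵈ p q q≺p

degₚ-+-≤ᵈ : ∀ p q {D} → degₚ p ≤ᵈ D → degₚ q ≤ᵈ D → degₚ (p +ₚ q) ≤ᵈ D
degₚ-+-≤ᵈ p       q       { -∞}   p≤D q≤D = ≤ᵈ-respˡ-≡ (sym (degₚ-+-≺ᵈ p q (≤ᵈ-∞⇒≺ᵈ q≤D))) p≤D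
degₚ-+-≤ᵈ []      q               _   q≤D = q≤D
degₚ-+-≤ᵈ (a ∷ p) []              p≤D _   = p≤D
degₚ-+-≤ᵈ (a ∷ p) (b ∷ q) {fin k} p≤D q≤D =
  ≤ᵈ-respˡ-≡ (sym (degₚ-∷ (a xor b) (p +ₚ q)))
    (cons-deg-≤ᵈ-fin (a xor b) k (degₚ-+-≤ᵈ p q (tail a p p≤D) (tail b q q≤D)))
  where
  tail : ∀ c r → degₚ (c ∷ r) ≤ᵈ fin k → degₚ r ≤ᵈ predᵈ k
  tail c r h = cons-deg-≤ᵈ-fin⁻¹ (degₚ r) k (≤ᵈ-respˡ-≡ (degₚ-∷ c r) h)

·ₚ-identityˡ : ∀ q → true ·ₚ q ≡ q
·ₚ-identityˡ []      = refl
·ₚ-identityˡ (b ∷ q) = cong (b ∷_) (·ₚ-identityˡ q)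

degₚ-false∷ : ∀ p → degₚ (false ∷ p) ≡ fin 1 +ᵈ degₚ p
degₚ-false∷ p = trans (degₚ-∷ false p) (cons-deg-false (degₚ p))

degₚ-false·ₚ : ∀ q → degₚ (false ·ₚ q) ≡ -∞
degₚ-false·ₚ []      = refl
degₚ-false·ₚ (b ∷ q) = trans (degₚ-false∷ (false ·ₚ q)) (cong (fin 1 +ᵈ_) (degₚ-false·ₚ q))

degₚ-·ₚ-+-shift : ∀ a d q r → degₚ r ≡ d +ᵈ degₚ q →
                  degₚ ((a ·ₚ q) +ₚ (false ∷ r)) ≡ cons-deg a d +ᵈ degₚ q
degₚ-·ₚ-+-shift false d q r r≡d+q = begin
  degₚ ((false ·ₚ q) +ₚ (false ∷ r)) ≡⟨ degₚ-+-≺ᵈʳ (false ·ₚ q) (false ∷ r) zero≺ ⟩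
  degₚ (false ∷ r)                   ≡⟨ degₚ-false∷ r ⟩
  fin 1 +ᵈ degₚ r                    ≡⟨ cong (fin 1 +ᵈ_) r≡d+q ⟩
  fin 1 +ᵈ (d +ᵈ degₚ q)             ≡⟨ +ᵈ-assoc (fin 1) d (degₚ q) ⟨
  (fin 1 +ᵈ d) +ᵈ degₚ q             ≡⟨ cong (_+ᵈ degₚ q) (cons-deg-false d) ⟨
  cons-deg false d +ᵈ degₚ q         ∎
  where
  zero≺ : degₚ (false ·ₚ q) ≺ᵈ degₚ (false ∷ r)
  zero≺ = ≺ᵈ-respˡ-≡ (sym (degₚ-false·ₚ q)) -∞≺
degₚ-·ₚ-+-shift true (fin n) q r r≡d+q = begin
  degₚ ((true ·ₚ q) +ₚ (false ∷ r)) ≡⟨ cong (λ s → degₚ (s +ₚ (false ∷ r))) (·ₚ-identityˡ q) ⟩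
  degₚ (q +ₚ (false ∷ r))           ≡⟨ degₚ-+-≺ᵈʳ q (false ∷ r) (subst (degₚ q ≺ᵈ_) (sym r′≡) (≺ᵈ-fin-suc+ᵈ n (degₚ q))) ⟩
  degₚ (false ∷ r)                  ≡⟨ r′≡ ⟩
  fin (suc n) +ᵈ degₚ q             ∎
  where
  r′≡ : degₚ (false ∷ r) ≡ fin (suc n) +ᵈ degₚ q
  r′≡ = trans (degₚ-false∷ r) (trans (cong (fin 1 +ᵈ_) r≡d+q) (sym (+ᵈ-assoc (fin 1) (fin n) (degₚ q))))
degₚ-·ₚ-+-shift true -∞ q r r≡d+q = begin
  degₚ ((true ·ₚ q) +ₚ (false ∷ r)) ≡⟨ cong (λ s → degₚ (s +ₚ (false ∷ r))) (·ₚ-identityˡ q) ⟩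
  degₚ (q +ₚ (false ∷ r))           ≡⟨ degₚ-+-≺ᵈ q (false ∷ r) (≺ᵈ-respˡ-≡ (sym r′≡) -∞≺) ⟩
  degₚ q                            ≡⟨ +ᵈ-identityˡ (degₚ q) ⟨
  fin 0 +ᵈ degₚ q                   ∎
  where
  r′≡ : degₚ (false ∷ r) ≡ -∞
  r′≡ = trans (degₚ-false∷ r) (cong (fin 1 +ᵈ_) r≡d+q)

degₚ-* : ∀ p q → degₚ (p *ₚ q) ≡ degₚ p +ᵈ degₚ q
degₚ-* []      q = refl
degₚ-* (a ∷ p) q = begin
  degₚ ((a ·ₚ q) +ₚ (false ∷ (p *ₚ q))) ≡⟨ degₚ-·ₚ-+-shift a (degₚ p) q (p *ₚ q) (degₚ-* p q) ⟩
  cons-deg a (degₚ p) +ᵈ degₚ q         ≡⟨ cong (_+ᵈ degₚ q) (degₚ-∷ a p) ⟨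
  degₚ (a ∷ p) +ᵈ degₚ q                ∎

degₚ-*-* : ∀ c p q → degₚ (c *ₚ (p *ₚ q)) ≡ (degₚ c +ᵈ degₚ p) +ᵈ degₚ q
degₚ-*-* c p q = begin
  degₚ (c *ₚ (p *ₚ q))             ≡⟨ degₚ-* c (p *ₚ q) ⟩
  degₚ c +ᵈ degₚ (p *ₚ q)          ≡⟨ cong (degₚ c +ᵈ_) (degₚ-* p q) ⟩
  degₚ c +ᵈ (degₚ p +ᵈ degₚ q)     ≡⟨ +ᵈ-assoc (degₚ c) (degₚ p) (degₚ q) ⟨
  (degₚ c +ᵈ degₚ p) +ᵈ degₚ q     ∎

degᴿ-*ᴿ : ∀ m₀ m₁ f₀ f₁ → (degₚ m₁ +ᵈ fin 2) ≤ᵈ degₚ m₀ →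
          degᴿ ((m₀ , m₁) *ᴿ (f₀ , f₁)) ≡ degₚ m₀ +ᵈ maxᵈ (degₚ f₀) (degₚ f₁)
degᴿ-*ᴿ m₀ m₁ f₀ f₁ m₁+2≤m₀ = [ f₀≤f₁-case , f₁≺f₀-case ]′ (≤ᵈ-or-≻ᵈ e₀ e₁)
  where
  d₀ d₁ e₀ e₁ : Deg
  d₀ = degₚ m₀
  d₁ = degₚ m₁
  e₀ = degₚ f₀
  e₁ = degₚ f₁

  t²m₁≤m₀ : (fin 2 +ᵈ d₁) ≤ᵈ d₀
  t²m₁≤m₀ = ≤ᵈ-respˡ-≡ (+ᵈ-comm d₁ (fin 2)) m₁+2≤m₀

  tm₁≺m₀ : (fin 1 +ᵈ d₁) ≺ᵈ d₀
  tm₁≺m₀ = fin1+ᵈ≤ᵈ⇒≺ᵈ (≤ᵈ-respˡ-≡ (+ᵈ-assoc (fin 1) (fin 1) d₁) t²m₁≤m₀)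

  m₁≺m₀ : d₁ ≺ᵈ d₀
  m₁≺m₀ = fin1+ᵈ≤ᵈ⇒≺ᵈ (≺ᵈ⇒≤ᵈ tm₁≺m₀)

  first second : F2[t]
  first  = (m₀ *ₚ f₀) +ₚ (t²+t+1 *ₚ (m₁ *ₚ f₁))
  second = ((m₀ *ₚ f₁) +ₚ (m₁ *ₚ f₀)) +ₚ (tₚ *ₚ (m₁ *ₚ f₁))

  f₀≤f₁-case : e₀ ≤ᵈ e₁ → maxᵈ (degₚ first) (degₚ second) ≡ d₀ +ᵈ maxᵈ e₀ e₁
  f₀≤f₁-case f₀≤f₁ = begin
    maxᵈ (degₚ first) (degₚ second) ≡⟨ cong (maxᵈ (degₚ first)) second≡ ⟩
    maxᵈ (degₚ first) (d₀ +ᵈ e₁)    ≡⟨ maxᵈ-≡ʳ first≤ ⟩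
    d₀ +ᵈ e₁                        ≡⟨ cong (d₀ +ᵈ_) (maxᵈ-≡ʳ f₀≤f₁) ⟨
    d₀ +ᵈ maxᵈ e₀ e₁                ∎
    where
    second≡ : degₚ second ≡ d₀ +ᵈ e₁
    second≡ =
      degₚ-+-≡ ((m₀ *ₚ f₁) +ₚ (m₁ *ₚ f₀)) (tₚ *ₚ (m₁ *ₚ f₁))
        (degₚ-+-≡ (m₀ *ₚ f₁) (m₁ *ₚ f₀) (degₚ-* m₀ f₁)
          (≺ᵈ-respˡ-≡ (sym (degₚ-* m₁ f₀)) (+ᵈ-mono-≺ᵈ-≤ᵈ m₁≺m₀ f₀≤f₁)))
        (≺ᵈ-respˡ-≡ (sym (degₚ-*-* tₚ m₁ f₁)) (+ᵈ-mono-≺ᵈ-≤ᵈ tm₁≺m₀ ≤ᵈ-refl))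
    first≤ : degₚ first ≤ᵈ (d₀ +ᵈ e₁)
    first≤ =
      degₚ-+-≤ᵈ (m₀ *ₚ f₀) (t²+t+1 *ₚ (m₁ *ₚ f₁))
        (≤ᵈ-respˡ-≡ (sym (degₚ-* m₀ f₀)) (+ᵈ-mono-≤ᵈ ≤ᵈ-refl f₀≤f₁))
        (≤ᵈ-respˡ-≡ (sym (degₚ-*-* t²+t+1 m₁ f₁)) (+ᵈ-mono-≤ᵈ t²m₁≤m₀ ≤ᵈ-refl))

  f₁≺f₀-case : e₁ ≺ᵈ e₀ → maxᵈ (degₚ first) (degₚ second) ≡ d₀ +ᵈ maxᵈ e₀ e₁
  f₁≺f₀-case f₁≺f₀ = begin
    maxᵈ (degₚ first) (degₚ second) ≡⟨ cong (λ d → maxᵈ d (degₚ second)) first≡ ⟩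
    maxᵈ (d₀ +ᵈ e₀) (degₚ second)   ≡⟨ maxᵈ-≡ˡ second≤ ⟩
    d₀ +ᵈ e₀                        ≡⟨ cong (d₀ +ᵈ_) (maxᵈ-≡ˡ (≺ᵈ⇒≤ᵈ f₁≺f₀)) ⟨
    d₀ +ᵈ maxᵈ e₀ e₁                ∎
    where
    first≡ : degₚ first ≡ d₀ +ᵈ e₀
    first≡ = degₚ-+-≡ (m₀ *ₚ f₀) (t²+t+1 *ₚ (m₁ *ₚ f₁)) (degₚ-* m₀ f₀)
               (≺ᵈ-respˡ-≡ (sym (degₚ-*-* t²+t+1 m₁ f₁)) (+ᵈ-mono-≤ᵈ-≺ᵈ t²m₁≤m₀ f₁≺f₀))
    second≤ : degₚ second ≤ᵈ (d₀ +ᵈ e₀)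
    second≤ =
      degₚ-+-≤ᵈ ((m₀ *ₚ f₁) +ₚ (m₁ *ₚ f₀)) (tₚ *ₚ (m₁ *ₚ f₁))
        (degₚ-+-≤ᵈ (m₀ *ₚ f₁) (m₁ *ₚ f₀) (≤ᵈ-respˡ-≡ (sym (degₚ-* m₀ f₁)) (+ᵈ-mono-≤ᵈ ≤ᵈ-refl (≺ᵈ⇒≤ᵈ f₁≺f₀)))
                       (≤ᵈ-respˡ-≡ (sym (degₚ-* m₁ f₀)) (+ᵈ-mono-≤ᵈ (≺ᵈ⇒≤ᵈ m₁≺m₀) ≤ᵈ-refl)))
        (≤ᵈ-respˡ-≡ (sym (degₚ-*-* tₚ m₁ f₁)) (+ᵈ-mono-≤ᵈ (≺ᵈ⇒≤ᵈ tm₁≺m₀) (≺ᵈ⇒≤ᵈ f₁≺f₀)))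

lemma3 : (m₀ m₁ f₀ f₁ : F2[t]) →
    (degₚ m₁ +ᵈ fin 2) ≤ᵈ degₚ m₀ →
    degᴿ ((m₀ , m₁) *ᴿ (f₀ , f₁)) ≡ degᴿ (m₀ , m₁) +ᵈ degᴿ (f₀ , f₁)
lemma3 m₀ m₁ f₀ f₁ m₁+2≤m₀ = begin
  degᴿ ((m₀ , m₁) *ᴿ (f₀ , f₁))    ≡⟨ degᴿ-*ᴿ m₀ m₁ f₀ f₁ m₁+2≤m₀ ⟩
  degₚ m₀ +ᵈ degᴿ (f₀ , f₁)        ≡⟨ cong (_+ᵈ degᴿ (f₀ , f₁)) (maxᵈ-≡ˡ (+ᵈ-fin-≤ᵈ⇒≤ᵈ m₁+2≤m₀)) ⟨
  degᴿ (m₀ , m₁) +ᵈ degᴿ (f₀ , f₁) ∎
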